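{- Let $n\geqslant 0$, let $\sigma$ be an inversion sequence of size $n$ avoiding the patterns $201$ and $210$, let $Z \subseteq \mathbf{Zeros}(\sigma)$, and let $\tau = \mathbf{child}(\sigma, Z)$. Then $\tau$ avoids $201$ and $210$ if and only if $Z \cap R(\sigma) \in \{\emptyset, R(\sigma)\}$.
   Context: An inversion sequence of size $n$ is a sequence $\sigma=(\sigma_1,\dots,\sigma_n)$ of integers with $\sigma_i\in\{0,\dots,i-1\}$. A sequence contains the pattern $201$ (resp. $210$) if it has entries $\sigma_a,\sigma_b,\sigma_c$ with $a<b<c$ and $\sigma_b<\sigma_c<\sigma_a$ (resp. $\sigma_c<\sigma_b<\sigma_a$); otherwise it avoids it. $\mathbf{Zeros}(\sigma)=\{i\in[1,n]:\sigma_i=0\}$. $L(\sigma)=\{i\in[1,n] : \sigma_j=0 \text{ for all } j\leqslant i\}$ is the set of leading zeros and $R(\sigma)=\mathbf{Zeros}(\sigma)\setminus L(\sigma)$. With $\chi$ the indicator function of a statement, $\mathbf{child}(\sigma,Z)=0\cdot(\sigma_i+\chi(\sigma_i>0)+\chi(i\in Z))_{i\in[1,n]}$ (prepend a $0$ to the sequence obtained by adding $1$ to each positive entry and to each zero at a position in $Z$). -}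

module Defs where

open import Data.Nat using (ℕ; zero; suc; _+_; _≤_; _<_; _≟_)
open import Data.Fin using (Fin; toℕ; _<_)
open import Data.Fin.Subset using (Subset; _∈_; _∉_; _∩_; ⊥; ⁅_⁆; _─_)
open import Data.Fin.Subset using (Side; inside; outside)
open import Data.Vec using (tabulate; lookup)
open import Data.Product using (Σ-syntax; ∃-syntax; _×_)
open import Data.Bool using (Bool; true; false; if_then_else_)
open import Data.Nat.Base using (_≡ᵇ_)
open import Relation.Binary.PropositionalEquality using (_≡_)
open import Relation.Nullary using (¬_)

-- Sequences of length n are functions Fin n → ℕ; position i : Fin n
-- corresponds to the paper's 1-based index toℕ i + 1.

IsInversionSeq : (n : ℕ) → (Fin n → ℕ) → Set
IsInversionSeq n σ = (i : Fin n) → σ i ≤ toℕ i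

Contains201 : {n : ℕ} → (Fin n → ℕ) → Set
Contains201 {n} σ = Σ[ a ∈ Fin n ] Σ[ b ∈ Fin n ] Σ[ c ∈ Fin n ]
  (a Data.Fin.< b) × (b Data.Fin.< c) × (σ b Data.Nat.< σ c) × (σ c Data.Nat.< σ a)

Contains210 : {n : ℕ} → (Fin n → ℕ) → Set
Contains210 {n} σ = Σ[ a ∈ Fin n ] Σ[ b ∈ Fin n ] Σ[ c ∈ Fin n ]
  (a Data.Fin.< b) × (b Data.Fin.< c) × (σ c Data.Nat.< σ b) × (σ b Data.Nat.< σ a)

Avoids201and210 : {n : ℕ} → (Fin n → ℕ) → Set
Avoids201and210 σ = ¬ Contains201 σ × ¬ Contains210 σ

isZero : ℕ → Bool
isZero zero = true
isZero (suc _) = false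

allZeroUpTo : {n : ℕ} → (Fin n → ℕ) → Fin n → Bool
allZeroUpTo {suc n} σ Fin.zero = isZero (σ Fin.zero)
allZeroUpTo {suc n} σ (Fin.suc i) =
  if isZero (σ Fin.zero) then allZeroUpTo (λ j → σ (Fin.suc j)) i else false

Zeros : {n : ℕ} → (Fin n → ℕ) → Subset n
Zeros σ = tabulate (λ i → if isZero (σ i) then inside else outside)

L : {n : ℕ} → (Fin n → ℕ) → Subset n
L σ = tabulate (λ i → if allZeroUpTo σ i then inside else outside)

-- R(σ) = Zeros(σ) \ L(σ)
R : {n : ℕ} → (Fin n → ℕ) → Subset n
R σ = tabulate (λ i → if isZero (σ i) then (if allZeroUpTo σ i then outside else inside) else outside)

χ : Bool → ℕ
χ true = 1
χ false = 0

child : {n : ℕ} → (Fin n → ℕ) → Subset n → (Fin (suc n) → ℕ)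
child σ Z Fin.zero = 0
child σ Z (Fin.suc i) = σ i + χ (if isZero (σ i) then false else true) + χ (lookup Z i)

-- Past its leading 0, τ = child σ Z sends a positive entry σᵢ to σᵢ + 1 ≥ 2 and a zero
-- to 1 or 0 according to whether i ∈ Z (Z only contains zeros of σ); so τ orders
-- positions lexicographically by (σᵢ, i ∈ Z). The largest entry of an occurrence of 201
-- or 210 in τ is thus a positive entry of σ, and the occurrence is one of σ unless its two
-- smaller entries are zeros of σ told apart by Z; following a positive entry, these zeros
-- lie in R(σ). Conversely, two elements of R(σ) told apart by Z form, together with a
-- positive entry preceding both, an occurrence of 201 or 210 in τ.
module Submission where

open import Defs
open import Data.Bool using (Bool; true; false; if_then_else_)
open import Data.Fin using (Fin; zero; suc; _<_; _≤_)
open import Data.Fin.Properties using (<-cmp; <-trans; ≤∧≢⇒<)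
open import Data.Fin.Subset using (Subset; _∈_; _⊆_; _∩_; ⊥; inside; outside)
open import Data.Fin.Subset.Properties
  using (nonempty?; Empty-unique; ∉⊥; x∈p∩q⁺; x∈p∩q⁻; p∩q⊆p; p∩q⊆q; ⊆-antisym)
import Data.Nat as ℕ
open import Data.Nat using (ℕ; zero; suc; z≤n; s≤s; z<s; s<s; s<s⁻¹; _≟_)
open import Data.Nat.Properties using (n≮0; n≢0⇒n>0; <⇒≤; ≤-refl; ≤-trans; +-identityʳ; +-comm)
open import Data.Product using (_×_; ∃-syntax; _,_)
open import Data.Sum using (_⊎_; inj₁; inj₂; [_,_])
open import Data.Vec using (lookup; tabulate)
open import Data.Vec.Properties using (lookup∘tabulate; lookup⇒[]=; []=⇒lookup)
open import Function.Bundles using (_⇔_; mk⇔)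
open import Function.Construct.Composition using (_⇔-∘_)
open import Function.Construct.Symmetry using (⇔-sym)
open import Relation.Binary.Definitions using (Tri; tri<; tri≈; tri>)
open import Relation.Binary.PropositionalEquality
  using (_≡_; _≢_; refl; sym; trans; cong; cong₂; subst; subst₂)
open import Relation.Nullary using (¬_; yes; no; contradiction)

AllOrNone : ∀ {n} → Subset n → Subset n → Set
AllOrNone Z A = ∀ {x y} → x ∈ A → y ∈ A → x ∈ Z → y ∈ Z

∩≡⊥⊎∩≡⇔AllOrNone : ∀ {n} {Z A : Subset n} → (Z ∩ A ≡ ⊥ ⊎ Z ∩ A ≡ A) ⇔ AllOrNone Z A
∩≡⊥⊎∩≡⇔AllOrNone {Z = Z} {A} = mk⇔ to from
  where
  to : Z ∩ A ≡ ⊥ ⊎ Z ∩ A ≡ A → AllOrNone Z A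
  to (inj₁ Z∩A≡⊥) {x} x∈A _ x∈Z = contradiction (subst (x ∈_) Z∩A≡⊥ (x∈p∩q⁺ (x∈Z , x∈A))) ∉⊥
  to (inj₂ Z∩A≡A) {y = y} _ y∈A _ = p∩q⊆p Z A (subst (y ∈_) (sym Z∩A≡A) y∈A)

  from : AllOrNone Z A → Z ∩ A ≡ ⊥ ⊎ Z ∩ A ≡ A
  from allOrNone with nonempty? (Z ∩ A)
  ... | no empty = inj₁ (Empty-unique empty)
  ... | yes (x , x∈Z∩A) with x∈p∩q⁻ Z A x∈Z∩A
  ...   | x∈Z , x∈A = inj₂ (⊆-antisym (p∩q⊆q Z A) (λ y∈A → x∈p∩q⁺ (allOrNone x∈A y∈A x∈Z , y∈A)))

isZero≡true⇒≡0 : ∀ {m} → isZero m ≡ true → m ≡ 0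
isZero≡true⇒≡0 {zero} _ = refl

isZero≡false⇒0< : ∀ {m} → isZero m ≡ false → 0 ℕ.< m
isZero≡false⇒0< {suc _} _ = z<s

0<⇒isZero≡false : ∀ {m} → 0 ℕ.< m → isZero m ≡ false
0<⇒isZero≡false z<s = refl

χ≤1 : ∀ b → χ b ℕ.≤ 1
χ≤1 true = ≤-refl
χ≤1 false = z≤n

χ-<⁻ : ∀ {a b} → χ a ℕ.< χ b → a ≡ false × b ≡ true
χ-<⁻ {false} {true} _ = refl , refl
χ-<⁻ {true} {true} (s<s ())
χ-<⁻ {_} {false} ()

allZeroUpTo≡false⇒ : ∀ {n} (σ : Fin n → ℕ) i → allZeroUpTo σ i ≡ false → ∃[ j ] j ≤ i × 0 ℕ.< σ j
allZeroUpTo≡false⇒ σ zero σ₀≢0 = zero , z≤n , isZero≡false⇒0< σ₀≢0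
allZeroUpTo≡false⇒ σ (suc i) e with isZero (σ zero) in σ₀
... | false = zero , z≤n , isZero≡false⇒0< σ₀
... | true with allZeroUpTo≡false⇒ (λ j → σ (suc j)) i e
...   | j , j≤i , 0<σj = suc j , s≤s j≤i , 0<σj

0<⇒allZeroUpTo≡false : ∀ {n} (σ : Fin n → ℕ) {i j} → j ≤ i → 0 ℕ.< σ j → allZeroUpTo σ i ≡ false
0<⇒allZeroUpTo≡false σ {zero} {zero} _ 0<σ₀ = 0<⇒isZero≡false 0<σ₀
0<⇒allZeroUpTo≡false σ {suc _} {zero} _ 0<σ₀ rewrite 0<⇒isZero≡false 0<σ₀ = refl
0<⇒allZeroUpTo≡false σ {suc i} {suc j} (s≤s j≤i) 0<σj with isZero (σ zero)
... | true = 0<⇒allZeroUpTo≡false (λ k → σ (suc k)) j≤i 0<σj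
... | false = refl

∈tabulate⁺ : ∀ {n} {f : Fin n → Bool} {i} → f i ≡ true → i ∈ tabulate f
∈tabulate⁺ {f = f} {i} fi≡true = lookup⇒[]= i (tabulate f) (trans (lookup∘tabulate f i) fi≡true)

∈tabulate⁻ : ∀ {n} {f : Fin n → Bool} {i} → i ∈ tabulate f → f i ≡ true
∈tabulate⁻ {f = f} {i} i∈f = trans (sym (lookup∘tabulate f i)) ([]=⇒lookup i∈f)

∈Zeros⇒≡0 : ∀ {n} {σ : Fin n → ℕ} {i} → i ∈ Zeros σ → σ i ≡ 0
∈Zeros⇒≡0 {σ = σ} {i} i∈Zeros with σ i | ∈tabulate⁻ i∈Zeros
... | zero | _ = refl
... | suc _ | ()

∈R⁺ : ∀ {n} {σ : Fin n → ℕ} {i j} → j < i → 0 ℕ.< σ j → σ i ≡ 0 → i ∈ R σ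
∈R⁺ {σ = σ} {i} j<i 0<σj σi≡0 = ∈tabulate⁺
  (cong₂ (λ s a → if isZero s then (if a then outside else inside) else outside)
         σi≡0 (0<⇒allZeroUpTo≡false σ (<⇒≤ j<i) 0<σj))

∈R⁻ : ∀ {n} {σ : Fin n → ℕ} {i} → i ∈ R σ → σ i ≡ 0 × ∃[ j ] j < i × 0 ℕ.< σ j
∈R⁻ {σ = σ} {i} i∈R
  with isZero (σ i) in σi | allZeroUpTo σ i in notAllZero | ∈tabulate⁻ i∈R
... | true | true | ()
... | false | _ | ()
... | true | false | _ with allZeroUpTo≡false⇒ σ i notAllZero
...   | j , j≤i , 0<σj = isZero≡true⇒≡0 σi , j , ≤∧≢⇒< j≤i j≢i , 0<σj
  where
  j≢i : j ≢ i
  j≢i refl = n≮0 (subst (0 ℕ.<_) (isZero≡true⇒≡0 σi) 0<σj)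

child-suc-zero : ∀ {n} (σ : Fin n → ℕ) (Z : Subset n) {i} →
                 σ i ≡ 0 → child σ Z (suc i) ≡ χ (lookup Z i)
child-suc-zero _ _ σi≡0 rewrite σi≡0 = refl

module _ {n} {σ : Fin n → ℕ} {Z : Subset n} (Z⊆Zeros : Z ⊆ Zeros σ) where

  0<⇒lookup≡false : ∀ {i} → 0 ℕ.< σ i → lookup Z i ≡ false
  0<⇒lookup≡false {i} 0<σi with lookup Z i in Zi
  ... | false = refl
  ... | true = contradiction (subst (0 ℕ.<_) (∈Zeros⇒≡0 (Z⊆Zeros (lookup⇒[]= i Z Zi))) 0<σi) n≮0

  child-suc-pos : ∀ {i} → 0 ℕ.< σ i → child σ Z (suc i) ≡ suc (σ i)
  child-suc-pos {i} 0<σi rewrite 0<⇒isZero≡false 0<σi | 0<⇒lookup≡false 0<σi =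
    trans (+-identityʳ (σ i ℕ.+ 1)) (+-comm (σ i) 1)

  child-<-reflect : ∀ {i j} → child σ Z (suc i) ℕ.< child σ Z (suc j) →
                    σ i ℕ.< σ j ⊎ (σ i ≡ 0 × σ j ≡ 0 × lookup Z i ≡ false × lookup Z j ≡ true)
  child-<-reflect {i} {j} τi<τj with σ i ≟ 0 | σ j ≟ 0
  ... | no σi≢0 | no σj≢0 =
    inj₁ (s<s⁻¹ (subst₂ ℕ._<_ (child-suc-pos (n≢0⇒n>0 σi≢0)) (child-suc-pos (n≢0⇒n>0 σj≢0)) τi<τj))
  ... | yes σi≡0 | no σj≢0 = inj₁ (subst (ℕ._< σ j) (sym σi≡0) (n≢0⇒n>0 σj≢0))
  ... | no σi≢0 | yes σj≡0 = contradiction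
    (≤-trans (subst₂ ℕ._<_ (child-suc-pos (n≢0⇒n>0 σi≢0)) (child-suc-zero σ Z σj≡0) τi<τj) (χ≤1 _))
    λ { (s≤s ()) }
  ... | yes σi≡0 | yes σj≡0 =
    inj₂ (σi≡0 , σj≡0 , χ-<⁻ (subst₂ ℕ._<_ (child-suc-zero σ Z σi≡0) (child-suc-zero σ Z σj≡0) τi<τj))

  child-chain-reflect : AllOrNone Z (R σ) → ∀ {a x y} → a < x → a < y →
                        child σ Z (suc x) ℕ.< child σ Z (suc y) →
                        child σ Z (suc y) ℕ.< child σ Z (suc a) →
                        σ x ℕ.< σ y × σ y ℕ.< σ a
  child-chain-reflect allOrNone {a} {x} {y} a<x a<y τx<τy τy<τa with child-<-reflect τy<τa
  ... | inj₂ (σy≡0 , _ , Zy≡false , _) = contradiction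
    (subst (child σ Z (suc x) ℕ.<_) (trans (child-suc-zero σ Z σy≡0) (cong χ Zy≡false)) τx<τy) n≮0
  ... | inj₁ σy<σa with child-<-reflect τx<τy
  ...   | inj₁ σx<σy = σx<σy , σy<σa
  ...   | inj₂ (σx≡0 , σy≡0 , Zx≡false , Zy≡true) =
    contradiction (trans (sym ([]=⇒lookup x∈Z)) Zx≡false) λ ()
    where
    0<σa : 0 ℕ.< σ a
    0<σa = subst (ℕ._< σ a) σy≡0 σy<σa
    x∈Z : x ∈ Z
    x∈Z = allOrNone (∈R⁺ a<y 0<σa σy≡0) (∈R⁺ a<x 0<σa σx≡0) (lookup⇒[]= y Z Zy≡true)

  AllOrNone⇒child-avoids : Avoids201and210 σ → AllOrNone Z (R σ) → Avoids201and210 (child σ Z)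
  AllOrNone⇒child-avoids (σ-avoids201 , σ-avoids210) allOrNone = τ-avoids201 , τ-avoids210
    where
    τ-avoids201 : ¬ Contains201 (child σ Z)
    τ-avoids201 (zero , _ , _ , _ , _ , _ , ())
    τ-avoids201 (suc _ , zero , _ , () , _)
    τ-avoids201 (suc _ , suc _ , zero , _ , () , _)
    τ-avoids201 (suc a , suc b , suc c , s<s a<b , s<s b<c , τb<τc , τc<τa) =
      let σb<σc , σc<σa = child-chain-reflect allOrNone a<b (<-trans a<b b<c) τb<τc τc<τa
      in σ-avoids201 (a , b , c , a<b , b<c , σb<σc , σc<σa)

    τ-avoids210 : ¬ Contains210 (child σ Z)
    τ-avoids210 (zero , _ , _ , _ , _ , _ , ())
    τ-avoids210 (suc _ , zero , _ , () , _)
    τ-avoids210 (suc _ , suc _ , zero , _ , () , _)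
    τ-avoids210 (suc a , suc b , suc c , s<s a<b , s<s b<c , τc<τb , τb<τa) =
      let σc<σb , σb<σa = child-chain-reflect allOrNone (<-trans a<b b<c) a<b τc<τb τb<τa
      in σ-avoids210 (a , b , c , a<b , b<c , σc<σb , σb<σa)

  R-separated⇒pattern : ∀ {x y} → x ∈ R σ → y ∈ R σ → lookup Z x ≡ true → lookup Z y ≡ false →
                        Contains201 (child σ Z) ⊎ Contains210 (child σ Z)
  R-separated⇒pattern {x} {y} x∈R y∈R Zx≡true Zy≡false with ∈R⁻ x∈R | ∈R⁻ y∈R
  ... | σx≡0 , i , i<x , 0<σi | σy≡0 , j , j<y , 0<σj = by-order (<-cmp x y)
    where
    τx≡1 : child σ Z (suc x) ≡ 1
    τx≡1 = trans (child-suc-zero σ Z σx≡0) (cong χ Zx≡true)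

    τy<τx : child σ Z (suc y) ℕ.< child σ Z (suc x)
    τy<τx = subst₂ ℕ._<_ (sym (trans (child-suc-zero σ Z σy≡0) (cong χ Zy≡false))) (sym τx≡1) z<s

    τx<τ : ∀ {k} → 0 ℕ.< σ k → child σ Z (suc x) ℕ.< child σ Z (suc k)
    τx<τ 0<σk = subst₂ ℕ._<_ (sym τx≡1) (sym (child-suc-pos 0<σk)) (s<s 0<σk)

    by-order : Tri (x < y) (x ≡ y) (y < x) → Contains201 (child σ Z) ⊎ Contains210 (child σ Z)
    by-order (tri< x<y _ _) = inj₂ (suc i , suc x , suc y , s<s i<x , s<s x<y , τy<τx , τx<τ 0<σi)
    by-order (tri≈ _ x≡y _) =
      contradiction (trans (sym Zx≡true) (trans (cong (lookup Z) x≡y) Zy≡false)) λ ()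
    by-order (tri> _ _ y<x) = inj₁ (suc j , suc y , suc x , s<s j<y , s<s y<x , τy<τx , τx<τ 0<σj)

  child-avoids⇒AllOrNone : Avoids201and210 (child σ Z) → AllOrNone Z (R σ)
  child-avoids⇒AllOrNone (τ-avoids201 , τ-avoids210) {x} {y} x∈R y∈R x∈Z with lookup Z y in Zy
  ... | true = lookup⇒[]= y Z Zy
  ... | false =
    contradiction (R-separated⇒pattern x∈R y∈R ([]=⇒lookup x∈Z) Zy) [ τ-avoids201 , τ-avoids210 ]

  child-avoids⇔AllOrNone : Avoids201and210 σ → Avoids201and210 (child σ Z) ⇔ AllOrNone Z (R σ)
  child-avoids⇔AllOrNone σ-avoids = mk⇔ child-avoids⇒AllOrNone (AllOrNone⇒child-avoids σ-avoids)

proposition3p1 : (n : ℕ) (σ : Fin n → ℕ) → IsInversionSeq n σ → Avoids201and210 σ →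
    (Z : Subset n) → Z ⊆ Zeros σ →
    Avoids201and210 (child σ Z) ⇔ ((Z ∩ R σ ≡ ⊥) ⊎ (Z ∩ R σ ≡ R σ))
proposition3p1 n σ _ σ-avoids Z Z⊆Zeros =
  ⇔-sym ∩≡⊥⊎∩≡⇔AllOrNone ⇔-∘ child-avoids⇔AllOrNone Z⊆Zeros σ-avoids
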